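{- Let $P$ be a Catalan power series with predual basis $(\tilde e_i)_{i\in\mathbb N^2}$. For each positive integer $n$ let $\Pi_n$ be the $n$-linear map on power series in $(z,t)$ defined on the predual basis by $$\Pi_n(\tilde e_{i_1},\dots,\tilde e_{i_n})(z,t)=\tilde e_{i_1}(z,t)\,\tilde e_{i_2}(q^{\langle i_1,\mathrm e_2\rangle}z,t)\cdots\tilde e_{i_n}(q^{\langle i_1+\dots+i_{n-1},\mathrm e_2\rangle}z,t)$$ and extended by $n$-linearity: if $f_{(j)}=\sum_if_{(j),i}\tilde e_i$ for $1\le j\le n$, then $\Pi_n(f_{(1)},\dots,f_{(n)})=\sum_{i_1,\dots,i_n}f_{(1),i_1}\cdots f_{(n),i_n}\Pi_n(\tilde e_{i_1},\dots,\tilde e_{i_n})$. Then: (i) $\Pi_n(\tilde e_{i_1},\dots,\tilde e_{i_n})=q^{B_n(i_1,\dots,i_n)}\tilde e_{i_1+\dots+i_n}$; (ii) $\Pi_n(f_1,\dots,f_n)=\Pi_2\bigl(f_1,\Pi_{n-1}(f_2,\dots,f_n)\bigr)=\Pi_2\bigl(\Pi_{n-1}(f_1,\dots,f_{n-1}),f_n\bigr)$; (iii) if $f=\sum_if_i\tilde e_i$ and $g=\sum_ig_i\tilde e_i$, then $\Pi_2(f,g)=\sum_{i,j\in\mathbb N^2}q^{B_2(i,j)+\det(i,j)}g_if_j\tilde e_{i+j}$.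
   Context: $q$ is a fixed parameter; all series are formal. $\mathrm e_1=(1,0)$, $\mathrm e_2=(0,1)$, $\langle\cdot,\cdot\rangle$ the usual inner product. A Catalan power series is a power series $P(z,t)$ with $P(z,t)=t-z\tilde P(z,t)t^2$ for some power series $\tilde P$. Its predual basis is $\tilde e_i(z,t)=z^{\langle i,\mathrm e_1\rangle}\prod_{0\le j<\langle i,\mathrm e_2\rangle}P(q^jz,t)$ for $i\in\mathbb N^2$ (empty product $=1$); it is a basis of power series in $(z,t)$. For $u_1,\dots,u_n\in\mathbb R^2$, $B_n(u_1,\dots,u_n)=\sum_{1\le a<b\le n}\langle u_a,\mathrm e_2\rangle\langle u_b,\mathrm e_1\rangle$ if $n\ge2$ and $B_n=0$ for $n=0,1$. For $i,j\in\mathbb N^2$, $\det(i,j)$ is the determinant of the $2\times2$ matrix with first column $i$ and second column $j$. -}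

module Defs where

import Level
open import Algebra.Bundles using (CommutativeRing)
open import Data.Nat as ℕ using (ℕ; zero; suc; _∸_; _≤ᵇ_)
open import Data.Nat.Properties using () renaming (_≟_ to _≟ℕ_)
open import Data.Product using (Σ; _×_; _,_; proj₁; proj₂)
open import Data.Product.Properties using (≡-dec)
open import Data.Vec using (Vec; []; _∷_)
open import Data.Bool using (Bool; true; false; if_then_else_; _∧_)
open import Data.Integer as ℤ using (ℤ)
open import Relation.Nullary.Decidable using (⌊_⌋)

-- ℕ² with componentwise addition; ⟨i,e₁⟩ = proj₁ i, ⟨i,e₂⟩ = proj₂ i
N2 : Set
N2 = ℕ × ℕ

_⊕_ : N2 → N2 → N2
(a , b) ⊕ (c , d) = (a ℕ.+ c , b ℕ.+ d)

_≟₂_ : (i j : N2) → _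
_≟₂_ = ≡-dec _≟ℕ_ _≟ℕ_

vsum : ∀ {n} → Vec N2 n → N2
vsum [] = (0 , 0)
vsum (i ∷ is) = i ⊕ vsum is

-- B_n(u₁,…,uₙ) = Σ_{a<b} ⟨u_a,e₂⟩⟨u_b,e₁⟩  (grouped by a); = 0 for n = 0,1
B : ∀ {n} → Vec N2 n → ℕ
B [] = 0
B (i ∷ is) = proj₂ i ℕ.* proj₁ (vsum is) ℕ.+ B is

det : N2 → N2 → ℤ
det (a , b) (c , d) = ℤ.+ (a ℕ.* d) ℤ.- ℤ.+ (b ℕ.* c)

module _ {c ℓ} (R : CommutativeRing c ℓ) where
  open CommutativeRing R

  -- formal power series in (z,t): f a b = coefficient of z^a t^b
  PS : Set c
  PS = ℕ → ℕ → Carrier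

  -- coefficient family (f_i)_{i ∈ ℕ²} w.r.t. the predual basis
  Fam : Set c
  Fam = N2 → Carrier

  _≈ₚ_ : PS → PS → Set ℓ
  f ≈ₚ g = ∀ a b → f a b ≈ g a b

  pow : Carrier → ℕ → Carrier
  pow x zero = 1#
  pow x (suc n) = x * pow x n

  Σ≤ : ℕ → (ℕ → Carrier) → Carrier
  Σ≤ zero F = F 0
  Σ≤ (suc n) F = Σ≤ n F + F (suc n)

  Σbox : N2 → (N2 → Carrier) → Carrier
  Σbox (a , b) F = Σ≤ a λ i → Σ≤ b λ j → F (i , j)

  isZero : ℕ → Bool
  isZero zero = true
  isZero (suc _) = false

  oneₚ : PS
  oneₚ a b = if isZero a ∧ isZero b then 1# else 0#

  zₚ : PS
  zₚ a b = if isZero (a ∸ 1) ∧ isZero (1 ∸ a) ∧ isZero b then 1# else 0#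

  tₚ : PS
  tₚ a b = if isZero a ∧ isZero (b ∸ 1) ∧ isZero (1 ∸ b) then 1# else 0#

  _-ₚ_ : PS → PS → PS
  (f -ₚ g) a b = f a b - g a b

  _*ₚ_ : PS → PS → PS
  (f *ₚ g) a b = Σbox (a , b) λ ij → f (proj₁ ij) (proj₂ ij) * g (a ∸ proj₁ ij) (b ∸ proj₂ ij)

  zpow : ℕ → PS → PS
  zpow k f a b = if k ≤ᵇ a then f (a ∸ k) b else 0#

  -- f(z,t) ↦ f(x z, t)
  dil : Carrier → PS → PS
  dil x f a b = pow x a * f a b

  scal : Carrier → PS → PS
  scal x f a b = x * f a b

  Catalan : PS → Set (c Level.⊔ ℓ)
  Catalan P = Σ PS λ P̃ → P ≈ₚ (tₚ -ₚ ((zₚ *ₚ P̃) *ₚ (tₚ *ₚ tₚ)))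

  -- Kronecker delta family: coefficients of ẽ_i in the predual basis
  δ : N2 → Fam
  δ i j = if ⌊ i ≟₂ j ⌋ then 1# else 0#

  module _ (q : Carrier) (P : PS) where

    prodP : ℕ → PS
    prodP zero = oneₚ
    prodP (suc m) = prodP m *ₚ dil (pow q m) P

    -- predual basis ẽ_i = z^{⟨i,e₁⟩} Π_{0≤j<⟨i,e₂⟩} P(q^j z,t)
    ẽ : N2 → PS
    ẽ (a , m) = zpow a (prodP m)

    -- Σ_i d_i ẽ_i.  For Catalan P, ẽ_i has z-order ≥ ⟨i,e₁⟩ and t-order ≥ ⟨i,e₂⟩,
    -- so the coefficient of z^a t^b only receives contributions from i ∈ [0..a]×[0..b].
    Expand : Fam → PS
    Expand d a b = Σbox (a , b) λ i → d i * ẽ i a b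

    -- ẽ_{i₁}(q^s z,t) ẽ_{i₂}(q^{s+⟨i₁,e₂⟩} z,t) ⋯  (s = running ⟨·,e₂⟩-partial sum)
    ΠbasisFrom : ∀ {n} → ℕ → Vec N2 n → PS
    ΠbasisFrom s [] = oneₚ
    ΠbasisFrom s (i ∷ is) = dil (pow q s) (ẽ i) *ₚ ΠbasisFrom (s ℕ.+ proj₂ i) is

    Πbasis : ∀ {n} → Vec N2 n → PS
    Πbasis = ΠbasisFrom 0

    sumTuples : ∀ {n} → N2 → Vec Fam n → (Vec N2 n → Carrier) → Carrier
    sumTuples box [] F = F []
    sumTuples box (f ∷ fs) F = Σbox box λ i → f i * sumTuples box fs (λ is → F (i ∷ is))

    -- n-linear extension Π_n(f_{(1)},…,f_{(n)}), f_{(j)} = Σ_i f_{(j),i} ẽ_i given by families.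
    -- Truncation to the box is exact since Π_n(ẽ_{i₁},…) = (up to q-power) ẽ_{i₁+…+iₙ}.
    Π : ∀ {n} → Vec Fam n → PS
    Π fs a b = sumTuples (a , b) fs λ is → Πbasis is a b

-- Write e_i for the predual basis element ẽ_i = z^{i₁} Π_{j<i₂} P(q^j z, t).
-- The whole proposition rests on three facts about this basis.
--   * Triangularity: e_i has z-order ≥ i₁ and t-order ≥ i₂ (because P(z,0) = 0),
--     and its coefficient of z^{i₁} t^{i₂} is 1 (because the t-coefficient of P
--     at z⁰ is 1).  Hence only indices in the box [0..a]×[0..b] contribute to the
--     coefficient of z^a t^b, and a basis expansion has unique coefficients.
--   * Product rule: e_i(q^s z,t) · e_j(q^{s+i₂} z,t) = q^{i₂ j₁} e_{i+j}(q^s z,t), which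
--     follows from Π_{j<m+k} P(q^j z,t) = Π_{j<m} P(q^j z,t) · Π_{j<k} P(q^{m+j} z,t).
--     By induction along the tuple this gives part (i): Π_n(e_{i₁},…,e_{iₙ}) = q^{B} e_{Σ i}.
--   * Multilinear bookkeeping: by (i), Π_n(f₁,…,fₙ) is the basis expansion with
--     coefficients C_k = Σ_{Σ i = k} f_{1,i₁}⋯f_{n,iₙ} q^{B(i)}; peeling off the first
--     or the last factor, and uniqueness of expansions, give part (ii); part (iii)
--     is (i) for n = 2 plus a rearrangement of the double sum.
module Submission where

open import Defs
open import Algebra.Bundles using (CommutativeRing)
open import Data.Nat using (ℕ; suc)
open import Data.Product using (_×_; _,_)
open import Data.Vec using (Vec; []; _∷_; map; head; tail; init; last)
open import Data.Integer as ℤ using ()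

open import Data.Nat using (zero; _≤_; _<_; _∸_; z≤n; s≤s; _≤ᵇ_)
import Data.Nat as ℕ
import Data.Nat.Properties as ℕₚ
open import Data.Nat.Tactic.RingSolver using (solve-∀)
import Data.Integer.Tactic.RingSolver as ℤSolver
open import Data.Product using (proj₁; proj₂)
open import Data.Sum using (_⊎_; inj₁; inj₂)
open import Data.Bool using (true; false; if_then_else_)
open import Data.Vec using (_∷ʳ_; initLast)
open import Data.Empty using (⊥-elim)
open import Data.Unit using (tt)
open import Function using (_∘_)
open import Relation.Binary.Bundles using (Setoid)
open import Relation.Binary.Definitions using (tri<; tri≈; tri>)
open import Relation.Binary.PropositionalEquality as ≡ using (_≡_; _≢_)
open import Relation.Nullary using (yes; no)
open import Relation.Nullary.Decidable using (⌊_⌋)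
import Relation.Binary.Reasoning.Setoid as SetoidReasoning

Outside : N2 → N2 → Set
Outside (a , b) k = a < proj₁ k ⊎ b < proj₂ k

data SomeOutside (box : N2) : ∀ {n} → Vec N2 n → Set where
  here  : ∀ {n i} {is : Vec N2 n} → Outside box i → SomeOutside box (i ∷ is)
  there : ∀ {n i} {is : Vec N2 n} → SomeOutside box is → SomeOutside box (i ∷ is)

Outside-⊕ˡ : ∀ box i j → Outside box i → Outside box (i ⊕ j)
Outside-⊕ˡ _ (i₁ , _) (j₁ , _) (inj₁ lt) = inj₁ (ℕₚ.<-≤-trans lt (ℕₚ.m≤m+n i₁ j₁))
Outside-⊕ˡ _ (_ , i₂) (_ , j₂) (inj₂ lt) = inj₂ (ℕₚ.<-≤-trans lt (ℕₚ.m≤m+n i₂ j₂))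

Outside-⊕ʳ : ∀ box i j → Outside box j → Outside box (i ⊕ j)
Outside-⊕ʳ _ (i₁ , _) (j₁ , _) (inj₁ lt) = inj₁ (ℕₚ.<-≤-trans lt (ℕₚ.m≤n+m j₁ i₁))
Outside-⊕ʳ _ (_ , i₂) (_ , j₂) (inj₂ lt) = inj₂ (ℕₚ.<-≤-trans lt (ℕₚ.m≤n+m j₂ i₂))

SomeOutside-vsum : ∀ {n} box (is : Vec N2 n) → SomeOutside box is → Outside box (vsum is)
SomeOutside-vsum box (i ∷ is) (here o)  = Outside-⊕ˡ box i (vsum is) o
SomeOutside-vsum box (i ∷ is) (there o) = Outside-⊕ʳ box i (vsum is) (SomeOutside-vsum box is o)

Outside⇒≢ : ∀ box k → Outside box k → k ≢ box
Outside⇒≢ _ _ (inj₁ lt) ≡.refl = ℕₚ.<-irrefl ≡.refl lt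
Outside⇒≢ _ _ (inj₂ lt) ≡.refl = ℕₚ.<-irrefl ≡.refl lt

⊕-comm : ∀ i j → i ⊕ j ≡ j ⊕ i
⊕-comm (a , b) (c , d) = ≡.cong₂ _,_ (ℕₚ.+-comm a c) (ℕₚ.+-comm b d)

⊕-assoc : ∀ i j k → (i ⊕ j) ⊕ k ≡ i ⊕ (j ⊕ k)
⊕-assoc (a , b) (c , d) (x , y) = ≡.cong₂ _,_ (ℕₚ.+-assoc a c x) (ℕₚ.+-assoc b d y)

vsum-∷ʳ : ∀ {n} (is : Vec N2 n) j → vsum (is ∷ʳ j) ≡ vsum is ⊕ j
vsum-∷ʳ [] (j₁ , j₂) = ≡.cong₂ _,_ (ℕₚ.+-identityʳ j₁) (ℕₚ.+-identityʳ j₂)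
vsum-∷ʳ (i ∷ is) j = ≡.trans (≡.cong (i ⊕_) (vsum-∷ʳ is j)) (≡.sym (⊕-assoc i (vsum is) j))

B-∷ʳ : ∀ {n} (is : Vec N2 n) j → B (is ∷ʳ j) ≡ B is ℕ.+ proj₂ (vsum is) ℕ.* proj₁ j
B-∷ʳ [] (j₁ , j₂) = ≡.cong (ℕ._+ 0) (ℕₚ.*-zeroʳ j₂)
B-∷ʳ (i ∷ is) j =
  ≡.trans (≡.cong₂ (λ v b → proj₂ i ℕ.* proj₁ v ℕ.+ b) (vsum-∷ʳ is j) (B-∷ʳ is j))
          (regroup (proj₂ i) (proj₁ (vsum is)) (proj₁ j) (B is) (proj₂ (vsum is)))
  where
  regroup : ∀ x v w b y → x ℕ.* (v ℕ.+ w) ℕ.+ (b ℕ.+ y ℕ.* w) ≡ (x ℕ.* v ℕ.+ b) ℕ.+ (x ℕ.+ y) ℕ.* w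
  regroup = solve-∀

vsum-pair : ∀ i j → vsum (i ∷ j ∷ []) ≡ i ⊕ j
vsum-pair (i₁ , i₂) (j₁ , j₂) =
  ≡.cong₂ (λ x y → (i₁ ℕ.+ x , i₂ ℕ.+ y)) (ℕₚ.+-identityʳ j₁) (ℕₚ.+-identityʳ j₂)

B-pair : ∀ i j → B (i ∷ j ∷ []) ≡ proj₂ i ℕ.* proj₁ j
B-pair (_ , i₂) (j₁ , j₂) = simplify i₂ j₁ j₂
  where
  simplify : ∀ x y w → x ℕ.* (y ℕ.+ 0) ℕ.+ (w ℕ.* 0 ℕ.+ 0) ≡ x ℕ.* y
  simplify = solve-∀

-- the exponent of part (iii): B₂(i,j) + det(i,j) = i₁ j₂ = B₂(j,i)
B+det : ∀ i j → ℤ.∣ ℤ.+ B (i ∷ j ∷ []) ℤ.+ det i j ∣ ≡ proj₂ j ℕ.* proj₁ i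
B+det i@(i₁ , i₂) j@(j₁ , j₂) =
  ≡.trans (≡.cong (λ x → ℤ.∣ ℤ.+ x ℤ.+ (ℤ.+ (i₁ ℕ.* j₂) ℤ.- ℤ.+ (i₂ ℕ.* j₁)) ∣) (B-pair i j))
  (≡.trans (≡.cong ℤ.∣_∣ (cancel (ℤ.+ (i₂ ℕ.* j₁)) (ℤ.+ (i₁ ℕ.* j₂)))) (ℕₚ.*-comm i₁ j₂))
  where
  cancel : ∀ x y → x ℤ.+ (y ℤ.- x) ≡ y
  cancel = ℤSolver.solve-∀

module Theory {c ℓ} (R : CommutativeRing c ℓ) where
  open CommutativeRing R hiding (zero)
  open import Algebra.Properties.Ring ring using (-0#≈0#; -‿+-comm; [y-z]x≈yx-zx; x∙y⁻¹≈ε⇒x≈y)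
  import Algebra.Properties.CommutativeSemiring.Exp commutativeSemiring as Exp
  module ≈-Reasoning = SetoidReasoning setoid

  ≡⇒≈ : ∀ {x y} → x ≡ y → x ≈ y
  ≡⇒≈ ≡.refl = refl

  *-swapˡ : ∀ x y z → x * (y * z) ≈ y * (x * z)
  *-swapˡ x y z = trans (sym (*-assoc x y z)) (trans (*-congʳ (*-comm x y)) (*-assoc y x z))

  infixr 8 _^_
  _^_ : Carrier → ℕ → Carrier
  _^_ = pow R

  ^≡Exp^ : ∀ x n → x ^ n ≡ x Exp.^ n
  ^≡Exp^ x zero = ≡.refl
  ^≡Exp^ x (suc n) = ≡.cong (x *_) (^≡Exp^ x n)

  ^-+ : ∀ x m n → x ^ (m ℕ.+ n) ≈ x ^ m * x ^ n
  ^-+ x m n rewrite ^≡Exp^ x (m ℕ.+ n) | ^≡Exp^ x m | ^≡Exp^ x n = Exp.^-homo-* x m n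

  ^-* : ∀ x m n → (x ^ m) ^ n ≈ x ^ (m ℕ.* n)
  ^-* x m n rewrite ^≡Exp^ (x ^ m) n | ^≡Exp^ x m | ^≡Exp^ x (m ℕ.* n) = Exp.^-assocʳ x m n

  ^-distrib-* : ∀ x y n → (x * y) ^ n ≈ x ^ n * y ^ n
  ^-distrib-* x y n rewrite ^≡Exp^ (x * y) n | ^≡Exp^ x n | ^≡Exp^ y n = Exp.^-distrib-* x y n

  ^-congˡ : ∀ {x y} n → x ≈ y → x ^ n ≈ y ^ n
  ^-congˡ {x} {y} n x≈y rewrite ^≡Exp^ x n | ^≡Exp^ y n = Exp.^-congˡ n x≈y

  1^ : ∀ n → 1# ^ n ≈ 1#
  1^ zero = refl
  1^ (suc n) = trans (*-identityˡ _) (1^ n)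

  ∑ : ℕ → (ℕ → Carrier) → Carrier
  ∑ = Σ≤ R

  ∑-cong : ∀ n {F G : ℕ → Carrier} → (∀ i → F i ≈ G i) → ∑ n F ≈ ∑ n G
  ∑-cong zero h = h 0
  ∑-cong (suc n) h = +-cong (∑-cong n h) (h (suc n))

  ∑-congᵇ : ∀ n {F G : ℕ → Carrier} → (∀ i → i ≤ n → F i ≈ G i) → ∑ n F ≈ ∑ n G
  ∑-congᵇ zero h = h 0 z≤n
  ∑-congᵇ (suc n) h = +-cong (∑-congᵇ n (λ i i≤n → h i (ℕₚ.m≤n⇒m≤1+n i≤n))) (h (suc n) ℕₚ.≤-refl)

  ∑-zero : ∀ n {F : ℕ → Carrier} → (∀ i → i ≤ n → F i ≈ 0#) → ∑ n F ≈ 0#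
  ∑-zero n h = trans (∑-congᵇ n h) (zeros n)
    where
    zeros : ∀ n → ∑ n (λ _ → 0#) ≈ 0#
    zeros zero = refl
    zeros (suc n) = trans (+-identityʳ _) (zeros n)

  ∑-+ : ∀ n (F G : ℕ → Carrier) → ∑ n (λ i → F i + G i) ≈ ∑ n F + ∑ n G
  ∑-+ zero F G = refl
  ∑-+ (suc n) F G = trans (+-congʳ (∑-+ n F G)) (+-medial⁻ _ _ _ _)
    where
    +-medial⁻ : ∀ a b x y → (a + b) + (x + y) ≈ (a + x) + (b + y)
    +-medial⁻ a b x y = begin
      (a + b) + (x + y)   ≈⟨ +-assoc a b (x + y) ⟩
      a + (b + (x + y))   ≈⟨ +-congˡ (trans (sym (+-assoc b x y)) (+-congʳ (+-comm b x))) ⟩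
      a + ((x + b) + y)   ≈⟨ +-congˡ (+-assoc x b y) ⟩
      a + (x + (b + y))   ≈⟨ sym (+-assoc a x (b + y)) ⟩
      (a + x) + (b + y)   ∎
      where open ≈-Reasoning

  ∑-neg : ∀ n (F : ℕ → Carrier) → ∑ n (λ i → - F i) ≈ - ∑ n F
  ∑-neg zero F = refl
  ∑-neg (suc n) F = trans (+-congʳ (∑-neg n F)) (-‿+-comm _ _)

  *-∑ : ∀ n x (F : ℕ → Carrier) → x * ∑ n F ≈ ∑ n (λ i → x * F i)
  *-∑ zero x F = refl
  *-∑ (suc n) x F = trans (distribˡ x _ _) (+-congʳ (*-∑ n x F))

  ∑-* : ∀ n x (F : ℕ → Carrier) → ∑ n F * x ≈ ∑ n (λ i → F i * x)
  ∑-* zero x F = refl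
  ∑-* (suc n) x F = trans (distribʳ x _ _) (+-congʳ (∑-* n x F))

  ∑-swap : ∀ a b (H : ℕ → ℕ → Carrier) → ∑ a (λ i → ∑ b (H i)) ≈ ∑ b (λ j → ∑ a (λ i → H i j))
  ∑-swap zero b H = refl
  ∑-swap (suc a) b H = trans (+-congʳ (∑-swap a b H)) (sym (∑-+ b _ _))

  ∑-peel : ∀ n (F : ℕ → Carrier) → ∑ (suc n) F ≈ F 0 + ∑ n (F ∘ suc)
  ∑-peel zero F = refl
  ∑-peel (suc n) F = trans (+-congʳ (∑-peel n F)) (+-assoc _ _ _)

  ∑-reverse : ∀ n (F : ℕ → Carrier) → ∑ n F ≈ ∑ n (λ i → F (n ∸ i))
  ∑-reverse zero F = refl
  ∑-reverse (suc n) F =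
    trans (+-comm _ _) (trans (+-congˡ (∑-reverse n F)) (sym (∑-peel n (λ i → F (suc n ∸ i)))))

  ∑-triangle : ∀ a (F : ℕ → ℕ → Carrier) →
    ∑ a (λ i → ∑ i (λ k → F k i)) ≈ ∑ a (λ k → ∑ (a ∸ k) (λ m → F k (k ℕ.+ m)))
  ∑-triangle zero F = refl
  ∑-triangle (suc a) F = begin
      ∑ (suc a) (λ i → ∑ i (λ k → F k i))
    ≈⟨ ∑-peel a _ ⟩
      F 0 0 + ∑ a (λ i → ∑ (suc i) (λ k → F k (suc i)))
    ≈⟨ +-congˡ (trans (∑-cong a (λ i → ∑-peel i (λ k → F k (suc i)))) (∑-+ a _ _)) ⟩
      F 0 0 + (∑ a (λ i → F 0 (suc i)) + ∑ a (λ i → ∑ i (λ k → F (suc k) (suc i))))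
    ≈⟨ sym (+-assoc _ _ _) ⟩
      (F 0 0 + ∑ a (λ i → F 0 (suc i))) + ∑ a (λ i → ∑ i (λ k → F (suc k) (suc i)))
    ≈⟨ +-cong (sym (∑-peel a (F 0))) (∑-triangle a (λ k i → F (suc k) (suc i))) ⟩
      ∑ (suc a) (F 0) + ∑ a (λ k → ∑ (a ∸ k) (λ m → F (suc k) (suc (k ℕ.+ m))))
    ≈⟨ sym (∑-peel a _) ⟩
      ∑ (suc a) (λ k → ∑ (suc a ∸ k) (λ m → F k (k ℕ.+ m)))
    ∎
    where open ≈-Reasoning

  ∑-pick : ∀ n k {F : ℕ → Carrier} → (∀ i → i ≤ n → i ≢ k → F i ≈ 0#) → (n < k → F k ≈ 0#) →
    ∑ n F ≈ F k
  ∑-pick zero zero off beyond = refl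
  ∑-pick zero (suc k) off beyond = trans (off 0 z≤n (λ ())) (sym (beyond (s≤s z≤n)))
  ∑-pick (suc n) k off beyond with k ℕₚ.≟ suc n
  ... | yes ≡.refl =
    trans (+-congʳ (∑-zero n (λ i i≤n → off i (ℕₚ.m≤n⇒m≤1+n i≤n) (ℕₚ.<⇒≢ (s≤s i≤n))))) (+-identityˡ _)
  ... | no k≢ =
    trans (+-cong (∑-pick n k (λ i i≤n → off i (ℕₚ.m≤n⇒m≤1+n i≤n))
                             (λ n<k → beyond (ℕₚ.≤∧≢⇒< n<k (k≢ ∘ ≡.sym))))
                  (off (suc n) ℕₚ.≤-refl (k≢ ∘ ≡.sym)))
          (+-identityʳ _)

  ∑-last : ∀ n {F : ℕ → Carrier} → (∀ i → i < n → F i ≈ 0#) → ∑ n F ≈ F n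
  ∑-last n h = ∑-pick n n (λ i i≤n i≢n → h i (ℕₚ.≤∧≢⇒< i≤n i≢n)) (⊥-elim ∘ ℕₚ.<-irrefl ≡.refl)

  ∑-head : ∀ n {F : ℕ → Carrier} → (∀ i → F (suc i) ≈ 0#) → ∑ n F ≈ F 0
  ∑-head n h = ∑-pick n 0 off (λ ())
    where
    off : ∀ i → i ≤ n → i ≢ 0 → _
    off zero _ 0≢0 = ⊥-elim (0≢0 ≡.refl)
    off (suc i) _ _ = h i

  ∑-truncate : ∀ n m {F : ℕ → Carrier} → m ≤ n → (∀ i → m < i → F i ≈ 0#) → ∑ n F ≈ ∑ m F
  ∑-truncate n m m≤n h with ℕₚ.m≤n⇒m<n∨m≡n m≤n
  ∑-truncate (suc n) m _ h | inj₁ (s≤s m≤n) =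
    trans (+-cong (∑-truncate n m m≤n h) (h (suc n) (s≤s m≤n))) (+-identityʳ _)
  ... | inj₂ ≡.refl = refl

  ∑-shift : ∀ k n (F : ℕ → Carrier) → (∀ i → i < k → F i ≈ 0#) → ∑ (k ℕ.+ n) F ≈ ∑ n (λ i → F (k ℕ.+ i))
  ∑-shift zero n F h = refl
  ∑-shift (suc k) n F h =
    trans (∑-peel (k ℕ.+ n) F)
    (trans (+-cong (h 0 (s≤s z≤n)) (∑-shift k n (F ∘ suc) (λ i i<k → h (suc i) (s≤s i<k))))
           (+-identityˡ _))

  ∑□ : N2 → (N2 → Carrier) → Carrier
  ∑□ = Σbox R

  ∑□-cong : ∀ box {F G : N2 → Carrier} → (∀ i → F i ≈ G i) → ∑□ box F ≈ ∑□ box G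
  ∑□-cong (a , b) h = ∑-cong a (λ i → ∑-cong b (λ j → h (i , j)))

  ∑□-congᵇ : ∀ a b {F G : N2 → Carrier} → (∀ i → proj₁ i ≤ a → proj₂ i ≤ b → F i ≈ G i) →
    ∑□ (a , b) F ≈ ∑□ (a , b) G
  ∑□-congᵇ a b h = ∑-congᵇ a (λ i i≤a → ∑-congᵇ b (λ j j≤b → h (i , j) i≤a j≤b))

  ∑□-zero : ∀ box {F : N2 → Carrier} → (∀ i → F i ≈ 0#) → ∑□ box F ≈ 0#
  ∑□-zero (a , b) h = ∑-zero a (λ i _ → ∑-zero b (λ j _ → h (i , j)))

  ∑□-+ : ∀ box (F G : N2 → Carrier) → ∑□ box (λ i → F i + G i) ≈ ∑□ box F + ∑□ box G
  ∑□-+ (a , b) F G = trans (∑-cong a (λ i → ∑-+ b _ _)) (∑-+ a _ _)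

  ∑□-neg : ∀ box (F : N2 → Carrier) → ∑□ box (λ i → - F i) ≈ - ∑□ box F
  ∑□-neg (a , b) F = trans (∑-cong a (λ i → ∑-neg b _)) (∑-neg a _)

  *-∑□ : ∀ box x (F : N2 → Carrier) → x * ∑□ box F ≈ ∑□ box (λ i → x * F i)
  *-∑□ (a , b) x F = trans (*-∑ a x _) (∑-cong a (λ i → *-∑ b x _))

  ∑□-swap : ∀ box (H : N2 → N2 → Carrier) →
    ∑□ box (λ i → ∑□ box (H i)) ≈ ∑□ box (λ j → ∑□ box (λ i → H i j))
  ∑□-swap (a , b) H = begin
      ∑ a (λ i₁ → ∑ b (λ i₂ → ∑ a (λ j₁ → ∑ b (λ j₂ → H (i₁ , i₂) (j₁ , j₂)))))
    ≈⟨ ∑-cong a (λ i₁ → ∑-swap b a _) ⟩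
      ∑ a (λ i₁ → ∑ a (λ j₁ → ∑ b (λ i₂ → ∑ b (λ j₂ → H (i₁ , i₂) (j₁ , j₂)))))
    ≈⟨ ∑-swap a a _ ⟩
      ∑ a (λ j₁ → ∑ a (λ i₁ → ∑ b (λ i₂ → ∑ b (λ j₂ → H (i₁ , i₂) (j₁ , j₂)))))
    ≈⟨ ∑-cong a (λ j₁ → ∑-cong a (λ i₁ → ∑-swap b b _)) ⟩
      ∑ a (λ j₁ → ∑ a (λ i₁ → ∑ b (λ j₂ → ∑ b (λ i₂ → H (i₁ , i₂) (j₁ , j₂)))))
    ≈⟨ ∑-cong a (λ j₁ → ∑-swap a b _) ⟩
      ∑ a (λ j₁ → ∑ b (λ j₂ → ∑ a (λ i₁ → ∑ b (λ i₂ → H (i₁ , i₂) (j₁ , j₂)))))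
    ∎
    where open ≈-Reasoning

  ∑□-truncate : ∀ a b a' b' {F : N2 → Carrier} → a' ≤ a → b' ≤ b →
    (∀ i → Outside (a' , b') i → F i ≈ 0#) → ∑□ (a , b) F ≈ ∑□ (a' , b') F
  ∑□-truncate a b a' b' a'≤a b'≤b h =
    trans (∑-cong a (λ i → ∑-truncate b b' b'≤b (λ j b'<j → h (i , j) (inj₂ b'<j))))
          (∑-truncate a a' a'≤a (λ i a'<i → ∑-zero b' (λ j _ → h (i , j) (inj₁ a'<i))))

  ∑□-pick : ∀ box u {F : N2 → Carrier} → (∀ k → k ≢ u → F k ≈ 0#) → (Outside box u → F u ≈ 0#) →
    ∑□ box F ≈ F u
  ∑□-pick (a , b) (u₁ , u₂) {F} off outside =
    trans (∑-pick a u₁ (λ i _ i≢u₁ → ∑-zero b (λ j _ → off (i , j) (i≢u₁ ∘ ≡.cong proj₁)))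
                       (λ a<u₁ → trans column (outside (inj₁ a<u₁))))
          column
    where
    column : ∑ b (λ j → F (u₁ , j)) ≈ F (u₁ , u₂)
    column = ∑-pick b u₂ (λ j _ j≢u₂ → off (u₁ , j) (j≢u₂ ∘ ≡.cong proj₂)) (outside ∘ inj₂)

  δ-at : N2 → Carrier → N2 → Carrier
  δ-at u x k = if ⌊ u ≟₂ k ⌋ then x else 0#

  ∑□-δ : ∀ box u x (H : N2 → Carrier) → (Outside box u → H u ≈ 0#) →
    ∑□ box (λ k → δ-at u x k * H k) ≈ x * H u
  ∑□-δ box u x H outside =
    trans (∑□-pick box u (λ k k≢u → trans (*-congʳ (δ-off k k≢u)) (zeroˡ _))
                         (λ o → trans (*-congʳ δ-on) (trans (*-congˡ (outside o)) (zeroʳ _))))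
          (*-congʳ δ-on)
    where
    δ-on : δ-at u x u ≈ x
    δ-on with u ≟₂ u
    ... | yes _ = refl
    ... | no u≢u = ⊥-elim (u≢u ≡.refl)
    δ-off : ∀ k → k ≢ u → δ-at u x k ≈ 0#
    δ-off k k≢u with u ≟₂ k
    ... | yes u≡k = ⊥-elim (k≢u (≡.sym u≡k))
    ... | no _ = refl

  -- Formal power series in (z,t), compared coefficientwise.

  infix 4 _≋_
  _≋_ : PS R → PS R → Set ℓ
  _≋_ = _≈ₚ_ R

  PS-setoid : Setoid c ℓ
  PS-setoid = record
    { Carrier = PS R
    ; _≈_ = _≋_
    ; isEquivalence = record
      { refl = λ _ _ → refl
      ; sym = λ f≋g a b → sym (f≋g a b)
      ; trans = λ f≋g g≋h a b → trans (f≋g a b) (g≋h a b)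
      }
    }

  module ≋-Reasoning = SetoidReasoning PS-setoid
  open Setoid PS-setoid using () renaming (refl to ≋-refl; sym to ≋-sym; trans to ≋-trans)

  infixl 7 _⋆_
  _⋆_ : PS R → PS R → PS R
  _⋆_ = _*ₚ_ R

  𝟙 : PS R
  𝟙 = oneₚ R

  dilate : Carrier → PS R → PS R
  dilate = dil R

  z^_·_ : ℕ → PS R → PS R
  z^ k · f = zpow R k f

  scale : Carrier → PS R → PS R
  scale = scal R

  ⋆-cong : ∀ {f f' g g'} → f ≋ f' → g ≋ g' → f ⋆ g ≋ f' ⋆ g'
  ⋆-cong f≋f' g≋g' a b = ∑-cong a (λ i → ∑-cong b (λ j → *-cong (f≋f' i j) (g≋g' _ _)))

  ⋆-congʳ-in-box : ∀ f {g g'} a b → (∀ x y → x ≤ a → y ≤ b → g x y ≈ g' x y) →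
    (f ⋆ g) a b ≈ (f ⋆ g') a b
  ⋆-congʳ-in-box f a b h =
    ∑-cong a (λ i → ∑-cong b (λ j → *-congˡ (h _ _ (ℕₚ.m∸n≤m a i) (ℕₚ.m∸n≤m b j))))

  ⋆-comm : ∀ f g → f ⋆ g ≋ g ⋆ f
  ⋆-comm f g a b = begin
      ∑ a (λ i → ∑ b (λ j → f i j * g (a ∸ i) (b ∸ j)))
    ≈⟨ trans (∑-cong a (λ i → ∑-reverse b _)) (∑-reverse a _) ⟩
      ∑ a (λ i → ∑ b (λ j → f (a ∸ i) (b ∸ j) * g (a ∸ (a ∸ i)) (b ∸ (b ∸ j))))
    ≈⟨ ∑□-congᵇ a b (λ (i , j) i≤a j≤b → trans (*-comm _ _)
         (*-congʳ (≡⇒≈ (≡.cong₂ g (ℕₚ.m∸[m∸n]≡n i≤a) (ℕₚ.m∸[m∸n]≡n j≤b))))) ⟩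
      ∑ a (λ i → ∑ b (λ j → g i j * f (a ∸ i) (b ∸ j)))
    ∎
    where open ≈-Reasoning

  ⋆-assoc : ∀ f g h → (f ⋆ g) ⋆ h ≋ f ⋆ (g ⋆ h)
  ⋆-assoc f g h a b = begin
      ∑ a (λ i → ∑ b (λ j → ∑ i (λ k → ∑ j (λ l → f k l * g (i ∸ k) (j ∸ l))) * h (a ∸ i) (b ∸ j)))
    ≈⟨ ∑-cong a (λ i → ∑-cong b (λ j → trans (∑-* i _ _) (∑-cong i (λ k → ∑-* j _ _)))) ⟩
      ∑ a (λ i → ∑ b (λ j → ∑ i (λ k → ∑ j (λ l → X i k j l))))
    ≈⟨ ∑-cong a (λ i → ∑-swap b i _) ⟩
      ∑ a (λ i → ∑ i (λ k → ∑ b (λ j → ∑ j (λ l → X i k j l))))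
    ≈⟨ ∑-triangle a (λ k i → ∑ b (λ j → ∑ j (λ l → X i k j l))) ⟩
      ∑ a (λ k → ∑ (a ∸ k) (λ m → ∑ b (λ j → ∑ j (λ l → X (k ℕ.+ m) k j l))))
    ≈⟨ ∑-cong a (λ k → ∑-cong (a ∸ k) (λ m → ∑-triangle b (λ l j → X (k ℕ.+ m) k j l))) ⟩
      ∑ a (λ k → ∑ (a ∸ k) (λ m → ∑ b (λ l → ∑ (b ∸ l) (λ n → X (k ℕ.+ m) k (l ℕ.+ n) l))))
    ≈⟨ ∑-cong a (λ k → ∑-swap (a ∸ k) b _) ⟩
      ∑ a (λ k → ∑ b (λ l → ∑ (a ∸ k) (λ m → ∑ (b ∸ l) (λ n → X (k ℕ.+ m) k (l ℕ.+ n) l))))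
    ≈⟨ ∑-cong a (λ k → ∑-cong b (λ l → ∑-cong (a ∸ k) (λ m → ∑-cong (b ∸ l) (λ n → reindex k l m n)))) ⟩
      ∑ a (λ k → ∑ b (λ l → ∑ (a ∸ k) (λ m → ∑ (b ∸ l) (λ n → f k l * (g m n * h (a ∸ k ∸ m) (b ∸ l ∸ n))))))
    ≈⟨ sym (∑-cong a (λ k → ∑-cong b (λ l → trans (*-∑ (a ∸ k) _ _) (∑-cong (a ∸ k) (λ m → *-∑ (b ∸ l) _ _))))) ⟩
      ∑ a (λ k → ∑ b (λ l → f k l * ∑ (a ∸ k) (λ m → ∑ (b ∸ l) (λ n → g m n * h (a ∸ k ∸ m) (b ∸ l ∸ n)))))
    ∎
    where
    open ≈-Reasoning
    X : ℕ → ℕ → ℕ → ℕ → Carrier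
    X i k j l = (f k l * g (i ∸ k) (j ∸ l)) * h (a ∸ i) (b ∸ j)
    reindex : ∀ k l m n → X (k ℕ.+ m) k (l ℕ.+ n) l ≈ f k l * (g m n * h (a ∸ k ∸ m) (b ∸ l ∸ n))
    reindex k l m n = trans (*-assoc _ _ _) (*-congˡ (*-cong
      (≡⇒≈ (≡.cong₂ g (ℕₚ.m+n∸m≡n k m) (ℕₚ.m+n∸m≡n l n)))
      (≡⇒≈ (≡.cong₂ h (≡.sym (ℕₚ.∸-+-assoc a k m)) (≡.sym (ℕₚ.∸-+-assoc b l n))))))

  ⋆-identityˡ : ∀ f → 𝟙 ⋆ f ≋ f
  ⋆-identityˡ f a b =
    trans (∑-head a (λ i → ∑-zero b (λ j _ → zeroˡ _)))
          (trans (∑-head b (λ j → zeroˡ _)) (*-identityˡ _))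

  ⋆-identityʳ : ∀ f → f ⋆ 𝟙 ≋ f
  ⋆-identityʳ f = ≋-trans (⋆-comm f 𝟙) (⋆-identityˡ f)

  scale-cong : ∀ {x y f g} → x ≈ y → f ≋ g → scale x f ≋ scale y g
  scale-cong x≈y f≋g a b = *-cong x≈y (f≋g a b)

  scale-scale : ∀ x y f → scale x (scale y f) ≋ scale (x * y) f
  scale-scale x y f a b = sym (*-assoc _ _ _)

  scale-⋆ˡ : ∀ x f g → scale x f ⋆ g ≋ scale x (f ⋆ g)
  scale-⋆ˡ x f g a b =
    trans (∑-cong a (λ i → ∑-cong b (λ j → *-assoc _ _ _)))
          (sym (trans (*-∑ a x _) (∑-cong a (λ i → *-∑ b x _))))

  scale-⋆ʳ : ∀ x f g → f ⋆ scale x g ≋ scale x (f ⋆ g)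
  scale-⋆ʳ x f g =
    ≋-trans (⋆-comm f (scale x g)) (≋-trans (scale-⋆ˡ x g f) (scale-cong refl (⋆-comm g f)))

  scale-⋆-scale : ∀ x y f g → scale x f ⋆ scale y g ≋ scale (x * y) (f ⋆ g)
  scale-⋆-scale x y f g = begin
    scale x f ⋆ scale y g        ≈⟨ scale-⋆ˡ x f (scale y g) ⟩
    scale x (f ⋆ scale y g)      ≈⟨ scale-cong refl (scale-⋆ʳ y f g) ⟩
    scale x (scale y (f ⋆ g))    ≈⟨ scale-scale x y (f ⋆ g) ⟩
    scale (x * y) (f ⋆ g)        ∎
    where open ≋-Reasoning

  dilate-cong : ∀ x {f g} → f ≋ g → dilate x f ≋ dilate x g
  dilate-cong x f≋g a b = *-congˡ (f≋g a b)

  dilate-congˡ : ∀ {x y} f → x ≈ y → dilate x f ≋ dilate y f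
  dilate-congˡ f x≈y a b = *-congʳ (^-congˡ a x≈y)

  dilate-dilate : ∀ x y f → dilate x (dilate y f) ≋ dilate (x * y) f
  dilate-dilate x y f a b = trans (sym (*-assoc _ _ _)) (*-congʳ (sym (^-distrib-* x y a)))

  dilate-1 : ∀ f → dilate 1# f ≋ f
  dilate-1 f a b = trans (*-congʳ (1^ a)) (*-identityˡ _)

  dilate-𝟙 : ∀ x → dilate x 𝟙 ≋ 𝟙
  dilate-𝟙 x zero b = *-identityˡ _
  dilate-𝟙 x (suc a) b = zeroʳ _

  dilate-⋆ : ∀ x f g → dilate x (f ⋆ g) ≋ dilate x f ⋆ dilate x g
  dilate-⋆ x f g a b =
    trans (*-∑ a _ _) (∑-congᵇ a (λ i i≤a → trans (*-∑ b _ _) (∑-cong b (λ j → split i j i≤a))))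
    where
    open ≈-Reasoning
    split : ∀ i j → i ≤ a →
      x ^ a * (f i j * g (a ∸ i) (b ∸ j)) ≈ (x ^ i * f i j) * (x ^ (a ∸ i) * g (a ∸ i) (b ∸ j))
    split i j i≤a = begin
        x ^ a * (f i j * g (a ∸ i) (b ∸ j))
      ≈⟨ *-congʳ (trans (≡⇒≈ (≡.cong (x ^_) (≡.sym (ℕₚ.m+[n∸m]≡n i≤a)))) (^-+ x i (a ∸ i))) ⟩
        (x ^ i * x ^ (a ∸ i)) * (f i j * g (a ∸ i) (b ∸ j))
      ≈⟨ trans (*-assoc _ _ _) (*-congˡ (*-swapˡ _ _ _)) ⟩
        x ^ i * (f i j * (x ^ (a ∸ i) * g (a ∸ i) (b ∸ j)))
      ≈⟨ sym (*-assoc _ _ _) ⟩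
        (x ^ i * f i j) * (x ^ (a ∸ i) * g (a ∸ i) (b ∸ j))
      ∎

  z^-in : ∀ k f {a} b → k ≤ a → (z^ k · f) a b ≡ f (a ∸ k) b
  z^-in k f {a} b k≤a with k ≤ᵇ a | ℕₚ.≤⇒≤ᵇ k≤a
  ... | true | _ = ≡.refl

  z^-out : ∀ k f {a} b → a < k → (z^ k · f) a b ≡ 0#
  z^-out k f {a} b a<k with k ≤ᵇ a | ℕₚ.≤ᵇ⇒≤ k a
  ... | false | _ = ≡.refl
  ... | true | k≤a = ⊥-elim (ℕₚ.<⇒≱ a<k (k≤a tt))

  z^-cong : ∀ k {f g} → f ≋ g → z^ k · f ≋ z^ k · g
  z^-cong k {f} {g} f≋g a b with k ℕₚ.≤? a
  ... | yes k≤a = begin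
          (z^ k · f) a b    ≡⟨ z^-in k f b k≤a ⟩
          f (a ∸ k) b       ≈⟨ f≋g (a ∸ k) b ⟩
          g (a ∸ k) b       ≡⟨ ≡.sym (z^-in k g b k≤a) ⟩
          (z^ k · g) a b    ∎
          where open ≈-Reasoning
  ... | no k≰a = trans (≡⇒≈ (z^-out k f b (ℕₚ.≰⇒> k≰a))) (sym (≡⇒≈ (z^-out k g b (ℕₚ.≰⇒> k≰a))))

  z^-⋆ : ∀ k f g → (z^ k · f) ⋆ g ≋ z^ k · (f ⋆ g)
  z^-⋆ k f g a b with k ℕₚ.≤? a
  ... | no k≰a =
    trans (∑-zero a (λ i i≤a → ∑-zero b (λ j _ → vanishes (ℕₚ.≤-<-trans i≤a (ℕₚ.≰⇒> k≰a)))))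
          (sym (≡⇒≈ (z^-out k (f ⋆ g) b (ℕₚ.≰⇒> k≰a))))
    where
    vanishes : ∀ {i j} → i < k → (z^ k · f) i j * g (a ∸ i) (b ∸ j) ≈ 0#
    vanishes {i} {j} i<k = trans (*-congʳ (≡⇒≈ (z^-out k f j i<k))) (zeroˡ _)
  ... | yes k≤a = begin
      ∑ a G
    ≡⟨ ≡.cong (λ n → ∑ n G) (≡.sym (ℕₚ.m+[n∸m]≡n k≤a)) ⟩
      ∑ (k ℕ.+ (a ∸ k)) G
    ≈⟨ ∑-shift k (a ∸ k) G (λ i i<k → ∑-zero b (λ j _ → trans (*-congʳ (≡⇒≈ (z^-out k f j i<k))) (zeroˡ _))) ⟩
      ∑ (a ∸ k) (λ i → G (k ℕ.+ i))
    ≈⟨ ∑-cong (a ∸ k) (λ i → ∑-cong b (λ j → *-cong (≡⇒≈ (shifted i j))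
         (≡⇒≈ (≡.cong (λ u → g u (b ∸ j)) (≡.sym (ℕₚ.∸-+-assoc a k i)))))) ⟩
      (f ⋆ g) (a ∸ k) b
    ≡⟨ ≡.sym (z^-in k (f ⋆ g) b k≤a) ⟩
      (z^ k · (f ⋆ g)) a b
    ∎
    where
    open ≈-Reasoning
    G : ℕ → Carrier
    G i = ∑ b (λ j → (z^ k · f) i j * g (a ∸ i) (b ∸ j))
    shifted : ∀ i j → (z^ k · f) (k ℕ.+ i) j ≡ f i j
    shifted i j = ≡.trans (z^-in k f j (ℕₚ.m≤m+n k i)) (≡.cong (λ u → f u j) (ℕₚ.m+n∸m≡n k i))

  z^-z^ : ∀ a c f → z^ a · (z^ c · f) ≋ z^ (a ℕ.+ c) · f
  z^-z^ a c f x y with a ℕₚ.≤? x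
  ... | no a≰x =
    ≡⇒≈ (≡.trans (z^-out a (z^ c · f) y (ℕₚ.≰⇒> a≰x))
                 (≡.sym (z^-out (a ℕ.+ c) f y (ℕₚ.<-≤-trans (ℕₚ.≰⇒> a≰x) (ℕₚ.m≤m+n a c)))))
  ... | yes a≤x with c ℕₚ.≤? (x ∸ a)
  ...   | yes c≤x-a = ≡⇒≈ (≡.trans (z^-in a (z^ c · f) y a≤x) (≡.trans (z^-in c f y c≤x-a)
                          (≡.trans (≡.cong (λ u → f u y) (ℕₚ.∸-+-assoc x a c))
                                   (≡.sym (z^-in (a ℕ.+ c) f y a+c≤x)))))
    where
    a+c≤x : a ℕ.+ c ≤ x
    a+c≤x = ≡.subst (a ℕ.+ c ≤_) (ℕₚ.m+[n∸m]≡n a≤x) (ℕₚ.+-monoʳ-≤ a c≤x-a)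
  ...   | no c≰x-a = ≡⇒≈ (≡.trans (z^-in a (z^ c · f) y a≤x) (≡.trans (z^-out c f y (ℕₚ.≰⇒> c≰x-a))
                          (≡.sym (z^-out (a ℕ.+ c) f y x<a+c))))
    where
    x<a+c : x < a ℕ.+ c
    x<a+c = ≡.subst (_< a ℕ.+ c) (ℕₚ.m+[n∸m]≡n a≤x) (ℕₚ.+-monoʳ-< a (ℕₚ.≰⇒> c≰x-a))

  z^-⋆-z^ : ∀ a c f g → (z^ a · f) ⋆ (z^ c · g) ≋ z^ (a ℕ.+ c) · (f ⋆ g)
  z^-⋆-z^ a c f g = begin
    (z^ a · f) ⋆ (z^ c · g)     ≈⟨ z^-⋆ a f (z^ c · g) ⟩
    z^ a · (f ⋆ (z^ c · g))     ≈⟨ z^-cong a (⋆-comm f (z^ c · g)) ⟩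
    z^ a · ((z^ c · g) ⋆ f)     ≈⟨ z^-cong a (z^-⋆ c g f) ⟩
    z^ a · (z^ c · (g ⋆ f))     ≈⟨ z^-z^ a c (g ⋆ f) ⟩
    z^ (a ℕ.+ c) · (g ⋆ f)      ≈⟨ z^-cong (a ℕ.+ c) (⋆-comm g f) ⟩
    z^ (a ℕ.+ c) · (f ⋆ g)      ∎
    where open ≋-Reasoning

  dilate-z^ : ∀ x k f → dilate x (z^ k · f) ≋ scale (x ^ k) (z^ k · dilate x f)
  dilate-z^ x k f a b with k ℕₚ.≤? a
  ... | no k≰a = trans (*-congˡ (≡⇒≈ (z^-out k f b (ℕₚ.≰⇒> k≰a))))
                   (trans (zeroʳ _) (sym (trans (*-congˡ (≡⇒≈ (z^-out k (dilate x f) b (ℕₚ.≰⇒> k≰a)))) (zeroʳ _))))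
  ... | yes k≤a = begin
      x ^ a * (z^ k · f) a b
    ≡⟨ ≡.cong (x ^ a *_) (z^-in k f b k≤a) ⟩
      x ^ a * f (a ∸ k) b
    ≈⟨ *-congʳ (trans (≡⇒≈ (≡.cong (x ^_) (≡.sym (ℕₚ.m+[n∸m]≡n k≤a)))) (^-+ x k (a ∸ k))) ⟩
      (x ^ k * x ^ (a ∸ k)) * f (a ∸ k) b
    ≈⟨ *-assoc _ _ _ ⟩
      x ^ k * dilate x f (a ∸ k) b
    ≡⟨ ≡.cong (x ^ k *_) (≡.sym (z^-in k (dilate x f) b k≤a)) ⟩
      x ^ k * (z^ k · dilate x f) a b
    ∎
    where open ≈-Reasoning

  HasTOrder : ℕ → PS R → Set ℓ
  HasTOrder m f = ∀ x y → y < m → f x y ≈ 0#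

  ⋆-TOrder : ∀ {m n f g} → HasTOrder m f → HasTOrder n g → HasTOrder (m ℕ.+ n) (f ⋆ g)
  ⋆-TOrder {m} {n} {f} {g} ord-f ord-g x y y<m+n = ∑-zero x (λ i _ → ∑-zero y (term i))
    where
    term : ∀ i j → j ≤ y → f i j * g (x ∸ i) (y ∸ j) ≈ 0#
    term i j j≤y with j ℕₚ.<? m
    ... | yes j<m = trans (*-congʳ (ord-f i j j<m)) (zeroˡ _)
    ... | no j≮m = trans (*-congˡ (ord-g _ _ y-j<n)) (zeroʳ _)
      where
      m≤j : m ≤ j
      m≤j = ℕₚ.≮⇒≥ j≮m
      y-j<n : y ∸ j < n
      y-j<n = ℕₚ.≤-<-trans (ℕₚ.∸-monoʳ-≤ y m≤j)
                (≡.subst (y ∸ m <_) (ℕₚ.m+n∸m≡n m n) (ℕₚ.∸-monoˡ-< y<m+n (ℕₚ.≤-trans m≤j j≤y)))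

  dilate-TOrder : ∀ {m f} x → HasTOrder m f → HasTOrder m (dilate x f)
  dilate-TOrder x ord-f a y y<m = trans (*-congˡ (ord-f a y y<m)) (zeroʳ _)

  ⋆-leading : ∀ {m n f g} → HasTOrder m f → HasTOrder n g → (f ⋆ g) 0 (m ℕ.+ n) ≈ f 0 m * g 0 n
  ⋆-leading {m} {n} {f} {g} ord-f ord-g =
    trans (∑-pick (m ℕ.+ n) m off (λ m+n<m → ⊥-elim (ℕₚ.<⇒≱ m+n<m (ℕₚ.m≤m+n m n))))
          (*-congˡ (≡⇒≈ (≡.cong (g 0) (ℕₚ.m+n∸m≡n m n))))
    where
    off : ∀ j → j ≤ m ℕ.+ n → j ≢ m → f 0 j * g 0 (m ℕ.+ n ∸ j) ≈ 0#
    off j j≤m+n j≢m with ℕₚ.<-cmp j m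
    ... | tri< j<m _ _ = trans (*-congʳ (ord-f 0 j j<m)) (zeroˡ _)
    ... | tri≈ _ j≡m _ = ⊥-elim (j≢m j≡m)
    ... | tri> _ _ m<j = trans (*-congˡ (ord-g 0 _ m+n-j<n)) (zeroʳ _)
      where
      m+n-j<n : m ℕ.+ n ∸ j < n
      m+n-j<n = ≡.subst (m ℕ.+ n ∸ j <_) (ℕₚ.m+n∸m≡n m n) (ℕₚ.∸-monoʳ-< m<j j≤m+n)

  ⋆-no-z⁰ : ∀ {f} g → (∀ y → f 0 y ≈ 0#) → ∀ y → (f ⋆ g) 0 y ≈ 0#
  ⋆-no-z⁰ g no-z⁰ y = ∑-zero y (λ j _ → trans (*-congʳ (no-z⁰ j)) (zeroˡ _))

  -- The predual basis of a Catalan series P.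

  module Basis (q : Carrier) (P : PS R) (catalan : Catalan R P) where

    P̃ : PS R
    P̃ = proj₁ catalan

    P-catalan : P ≋ _-ₚ_ R (tₚ R) ((zₚ R ⋆ P̃) ⋆ (tₚ R ⋆ tₚ R))
    P-catalan = proj₂ catalan

    -- P(z,0) = 0, since t divides t - z P̃ t²
    P-TOrder : HasTOrder 1 P
    P-TOrder x zero (s≤s z≤n) =
      trans (P-catalan x 0) (trans (+-cong (t-TOrder x 0 (s≤s z≤n)) (-‿cong zP̃t²-vanishes)) (-‿inverseʳ 0#))
      where
      t-TOrder : HasTOrder 1 (tₚ R)
      t-TOrder zero zero (s≤s z≤n) = refl
      t-TOrder (suc x) zero (s≤s z≤n) = refl
      zP̃t²-vanishes : ((zₚ R ⋆ P̃) ⋆ (tₚ R ⋆ tₚ R)) x 0 ≈ 0#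
      zP̃t²-vanishes = ⋆-TOrder {0} {2} {zₚ R ⋆ P̃} (λ _ _ ())
                        (⋆-TOrder {1} {1} {tₚ R} {tₚ R} t-TOrder t-TOrder) x 0 (s≤s z≤n)

    -- the coefficient of z⁰t¹ in P is 1, since z divides z P̃ t²
    P-01 : P 0 1 ≈ 1#
    P-01 = trans (P-catalan 0 1) (trans (+-congˡ (trans (-‿cong zP̃t²-vanishes) -0#≈0#)) (+-identityʳ 1#))
      where
      zP̃t²-vanishes : ((zₚ R ⋆ P̃) ⋆ (tₚ R ⋆ tₚ R)) 0 1 ≈ 0#
      zP̃t²-vanishes = ⋆-no-z⁰ {zₚ R ⋆ P̃} (tₚ R ⋆ tₚ R) (⋆-no-z⁰ {zₚ R} P̃ (λ _ → refl)) 1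

    ∏P : ℕ → PS R
    ∏P = prodP R q P

    ∏P-TOrder : ∀ m → HasTOrder m (∏P m)
    ∏P-TOrder zero _ _ ()
    ∏P-TOrder (suc m) = ≡.subst (λ k → HasTOrder k (∏P (suc m))) (ℕₚ.+-comm m 1)
                          (⋆-TOrder (∏P-TOrder m) (dilate-TOrder (q ^ m) P-TOrder))

    ∏P-leading : ∀ m → ∏P m 0 m ≈ 1#
    ∏P-leading zero = refl
    ∏P-leading (suc m) = begin
        ∏P (suc m) 0 (suc m)
      ≡⟨ ≡.cong (∏P (suc m) 0) (ℕₚ.+-comm 1 m) ⟩
        ∏P (suc m) 0 (m ℕ.+ 1)
      ≈⟨ ⋆-leading (∏P-TOrder m) (dilate-TOrder (q ^ m) P-TOrder) ⟩
        ∏P m 0 m * (1# * P 0 1)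
      ≈⟨ *-cong (∏P-leading m) (trans (*-identityˡ _) P-01) ⟩
        1# * 1#
      ≈⟨ *-identityˡ 1# ⟩
        1#
      ∎
      where open ≈-Reasoning

    ∏P-+ : ∀ m k → ∏P (m ℕ.+ k) ≋ ∏P m ⋆ dilate (q ^ m) (∏P k)
    ∏P-+ m zero = begin
        ∏P (m ℕ.+ 0)                  ≡⟨ ≡.cong ∏P (ℕₚ.+-identityʳ m) ⟩
        ∏P m                          ≈⟨ ≋-sym (⋆-identityʳ (∏P m)) ⟩
        ∏P m ⋆ 𝟙                      ≈⟨ ⋆-cong ≋-refl (≋-sym (dilate-𝟙 (q ^ m))) ⟩
        ∏P m ⋆ dilate (q ^ m) 𝟙       ∎
      where open ≋-Reasoning
    ∏P-+ m (suc k) = begin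
        ∏P (m ℕ.+ suc k)
      ≡⟨ ≡.cong ∏P (ℕₚ.+-suc m k) ⟩
        ∏P (m ℕ.+ k) ⋆ dilate (q ^ (m ℕ.+ k)) P
      ≈⟨ ⋆-cong {g = dilate (q ^ (m ℕ.+ k)) P} (∏P-+ m k) ≋-refl ⟩
        (∏P m ⋆ dilate (q ^ m) (∏P k)) ⋆ dilate (q ^ (m ℕ.+ k)) P
      ≈⟨ ⋆-assoc (∏P m) (dilate (q ^ m) (∏P k)) (dilate (q ^ (m ℕ.+ k)) P) ⟩
        ∏P m ⋆ (dilate (q ^ m) (∏P k) ⋆ dilate (q ^ (m ℕ.+ k)) P)
      ≈⟨ ⋆-cong ≋-refl (⋆-cong ≋-refl (≋-trans (dilate-congˡ P (^-+ q m k)) (≋-sym (dilate-dilate _ _ P)))) ⟩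
        ∏P m ⋆ (dilate (q ^ m) (∏P k) ⋆ dilate (q ^ m) (dilate (q ^ k) P))
      ≈⟨ ⋆-cong ≋-refl (≋-sym (dilate-⋆ (q ^ m) (∏P k) (dilate (q ^ k) P))) ⟩
        ∏P m ⋆ dilate (q ^ m) (∏P (suc k))
      ∎
      where open ≋-Reasoning

    ∏P-+-dilated : ∀ s m k →
      dilate (q ^ s) (∏P m) ⋆ dilate (q ^ (s ℕ.+ m)) (∏P k) ≋ dilate (q ^ s) (∏P (m ℕ.+ k))
    ∏P-+-dilated s m k = begin
        dilate (q ^ s) (∏P m) ⋆ dilate (q ^ (s ℕ.+ m)) (∏P k)
      ≈⟨ ⋆-cong ≋-refl (≋-trans (dilate-congˡ (∏P k) (^-+ q s m)) (≋-sym (dilate-dilate _ _ _))) ⟩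
        dilate (q ^ s) (∏P m) ⋆ dilate (q ^ s) (dilate (q ^ m) (∏P k))
      ≈⟨ ≋-sym (dilate-⋆ (q ^ s) (∏P m) (dilate (q ^ m) (∏P k))) ⟩
        dilate (q ^ s) (∏P m ⋆ dilate (q ^ m) (∏P k))
      ≈⟨ dilate-cong (q ^ s) (≋-sym (∏P-+ m k)) ⟩
        dilate (q ^ s) (∏P (m ℕ.+ k))
      ∎
      where open ≋-Reasoning

    e : N2 → PS R
    e = ẽ R q P

    e-outside : ∀ x y k → Outside (x , y) k → e k x y ≈ 0#
    e-outside x y (a , m) (inj₁ x<a) = ≡⇒≈ (z^-out a (∏P m) y x<a)
    e-outside x y (a , m) (inj₂ y<m) with a ℕₚ.≤? x
    ... | yes a≤x = trans (≡⇒≈ (z^-in a (∏P m) y a≤x)) (∏P-TOrder m (x ∸ a) y y<m)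
    ... | no a≰x = ≡⇒≈ (z^-out a (∏P m) y (ℕₚ.≰⇒> a≰x))

    e-corner : ∀ a m → e (a , m) a m ≈ 1#
    e-corner a m = trans (≡⇒≈ (≡.trans (z^-in a (∏P m) m ℕₚ.≤-refl) (≡.cong (λ u → ∏P m u m) (ℕₚ.n∸n≡0 a))))
                         (∏P-leading m)

    exponent-shift : ∀ s a m c → (q ^ s) ^ a * (q ^ (s ℕ.+ m)) ^ c ≈ q ^ (m ℕ.* c) * (q ^ s) ^ (a ℕ.+ c)
    exponent-shift s a m c = begin
        (q ^ s) ^ a * (q ^ (s ℕ.+ m)) ^ c
      ≈⟨ *-cong (^-* q s a) (^-* q (s ℕ.+ m) c) ⟩
        q ^ (s ℕ.* a) * q ^ ((s ℕ.+ m) ℕ.* c)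
      ≈⟨ sym (^-+ q (s ℕ.* a) ((s ℕ.+ m) ℕ.* c)) ⟩
        q ^ (s ℕ.* a ℕ.+ (s ℕ.+ m) ℕ.* c)
      ≡⟨ ≡.cong (q ^_) (regroup s a m c) ⟩
        q ^ (m ℕ.* c ℕ.+ s ℕ.* (a ℕ.+ c))
      ≈⟨ trans (^-+ q (m ℕ.* c) (s ℕ.* (a ℕ.+ c))) (*-congˡ (sym (^-* q s (a ℕ.+ c)))) ⟩
        q ^ (m ℕ.* c) * (q ^ s) ^ (a ℕ.+ c)
      ∎
      where
      open ≈-Reasoning
      regroup : ∀ s a m c → s ℕ.* a ℕ.+ (s ℕ.+ m) ℕ.* c ≡ m ℕ.* c ℕ.+ s ℕ.* (a ℕ.+ c)
      regroup = solve-∀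

    e-product : ∀ s i j →
      dilate (q ^ s) (e i) ⋆ dilate (q ^ (s ℕ.+ proj₂ i)) (e j)
        ≋ scale (q ^ (proj₂ i ℕ.* proj₁ j)) (dilate (q ^ s) (e (i ⊕ j)))
    e-product s (a , m) (c , k) = begin
        dilate (q ^ s) (z^ a · ∏P m) ⋆ dilate (q ^ (s ℕ.+ m)) (z^ c · ∏P k)
      ≈⟨ ⋆-cong (dilate-z^ (q ^ s) a (∏P m)) (dilate-z^ (q ^ (s ℕ.+ m)) c (∏P k)) ⟩
        scale α (z^ a · X) ⋆ scale β (z^ c · Y)
      ≈⟨ scale-⋆-scale α β (z^ a · X) (z^ c · Y) ⟩
        scale (α * β) ((z^ a · X) ⋆ (z^ c · Y))
      ≈⟨ scale-cong (exponent-shift s a m c) (z^-⋆-z^ a c X Y) ⟩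
        scale (q ^ (m ℕ.* c) * (q ^ s) ^ (a ℕ.+ c)) (z^ (a ℕ.+ c) · (X ⋆ Y))
      ≈⟨ ≋-sym (scale-scale _ _ _) ⟩
        scale (q ^ (m ℕ.* c)) (scale ((q ^ s) ^ (a ℕ.+ c)) (z^ (a ℕ.+ c) · (X ⋆ Y)))
      ≈⟨ scale-cong refl (scale-cong refl (z^-cong (a ℕ.+ c) (∏P-+-dilated s m k))) ⟩
        scale (q ^ (m ℕ.* c)) (scale ((q ^ s) ^ (a ℕ.+ c)) (z^ (a ℕ.+ c) · dilate (q ^ s) (∏P (m ℕ.+ k))))
      ≈⟨ scale-cong refl (≋-sym (dilate-z^ (q ^ s) (a ℕ.+ c) (∏P (m ℕ.+ k)))) ⟩
        scale (q ^ (m ℕ.* c)) (dilate (q ^ s) (z^ (a ℕ.+ c) · ∏P (m ℕ.+ k)))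
      ∎
      where
      open ≋-Reasoning
      α β : Carrier
      α = (q ^ s) ^ a
      β = (q ^ (s ℕ.+ m)) ^ c
      X Y : PS R
      X = dilate (q ^ s) (∏P m)
      Y = dilate (q ^ (s ℕ.+ m)) (∏P k)

    ΠbasisFrom-e : ∀ {n} s (is : Vec N2 n) →
      ΠbasisFrom R q P s is ≋ scale (q ^ B is) (dilate (q ^ s) (e (vsum is)))
    ΠbasisFrom-e s [] zero b = sym (trans (*-identityˡ _) (*-identityˡ _))
    ΠbasisFrom-e s [] (suc a) b = sym (trans (*-identityˡ _) (zeroʳ _))
    ΠbasisFrom-e s (i ∷ is) = begin
        dilate (q ^ s) (e i) ⋆ ΠbasisFrom R q P (s ℕ.+ proj₂ i) is
      ≈⟨ ⋆-cong ≋-refl (ΠbasisFrom-e (s ℕ.+ proj₂ i) is) ⟩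
        dilate (q ^ s) (e i) ⋆ scale (q ^ B is) (dilate (q ^ (s ℕ.+ proj₂ i)) (e (vsum is)))
      ≈⟨ scale-⋆ʳ (q ^ B is) (dilate (q ^ s) (e i)) (dilate (q ^ (s ℕ.+ proj₂ i)) (e (vsum is))) ⟩
        scale (q ^ B is) (dilate (q ^ s) (e i) ⋆ dilate (q ^ (s ℕ.+ proj₂ i)) (e (vsum is)))
      ≈⟨ scale-cong refl (e-product s i (vsum is)) ⟩
        scale (q ^ B is) (scale (q ^ (proj₂ i ℕ.* proj₁ (vsum is))) (dilate (q ^ s) (e (i ⊕ vsum is))))
      ≈⟨ scale-scale _ _ _ ⟩
        scale (q ^ B is * q ^ (proj₂ i ℕ.* proj₁ (vsum is))) (dilate (q ^ s) (e (i ⊕ vsum is)))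
      ≈⟨ scale-cong (trans (*-comm _ _) (sym (^-+ q (proj₂ i ℕ.* proj₁ (vsum is)) (B is)))) ≋-refl ⟩
        scale (q ^ B (i ∷ is)) (dilate (q ^ s) (e (vsum (i ∷ is))))
      ∎
      where open ≋-Reasoning

    Πbasis-e : ∀ {n} (is : Vec N2 n) → Πbasis R q P is ≋ scale (q ^ B is) (e (vsum is))
    Πbasis-e is = ≋-trans (ΠbasisFrom-e 0 is) (scale-cong refl (dilate-1 (e (vsum is))))

    ΠbasisFrom-dilate : ∀ {n} s (is : Vec N2 n) → ΠbasisFrom R q P s is ≋ dilate (q ^ s) (Πbasis R q P is)
    ΠbasisFrom-dilate s is x y =
      trans (ΠbasisFrom-e s is x y) (trans (*-swapˡ _ _ _) (*-congˡ (sym (Πbasis-e is x y))))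

    Πbasis-pair : ∀ i j a b → Πbasis R q P (i ∷ j ∷ []) a b ≈ q ^ (proj₂ i ℕ.* proj₁ j) * e (i ⊕ j) a b
    Πbasis-pair i j a b = trans (Πbasis-e (i ∷ j ∷ []) a b)
      (*-cong (≡⇒≈ (≡.cong (q ^_) (B-pair i j))) (≡⇒≈ (≡.cong (λ k → e k a b) (vsum-pair i j))))

    Πbasis-outside : ∀ {n} a b (js : Vec N2 n) → SomeOutside (a , b) js → Πbasis R q P js a b ≈ 0#
    Πbasis-outside a b js o =
      trans (Πbasis-e js a b) (trans (*-congˡ (e-outside a b (vsum js) (SomeOutside-vsum (a , b) js o))) (zeroʳ _))

    tuples : ∀ {n} → N2 → Vec (Fam R) n → (Vec N2 n → Carrier) → Carrier
    tuples = sumTuples R q P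

    tuples-cong : ∀ {n} box (fs : Vec (Fam R) n) {F G : Vec N2 n → Carrier} →
      (∀ is → F is ≈ G is) → tuples box fs F ≈ tuples box fs G
    tuples-cong box [] h = h []
    tuples-cong box (f ∷ fs) h = ∑□-cong box (λ i → *-congˡ (tuples-cong box fs (h ∘ (i ∷_))))

    tuples-zero : ∀ {n} box (fs : Vec (Fam R) n) {F : Vec N2 n → Carrier} →
      (∀ is → F is ≈ 0#) → tuples box fs F ≈ 0#
    tuples-zero box [] h = h []
    tuples-zero box (f ∷ fs) h = ∑□-zero box (λ i → trans (*-congˡ (tuples-zero box fs (h ∘ (i ∷_)))) (zeroʳ _))

    tuples-+ : ∀ {n} box (fs : Vec (Fam R) n) (F G : Vec N2 n → Carrier) →
      tuples box fs (λ is → F is + G is) ≈ tuples box fs F + tuples box fs G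
    tuples-+ box [] F G = refl
    tuples-+ box (f ∷ fs) F G =
      trans (∑□-cong box (λ i → trans (*-congˡ (tuples-+ box fs _ _)) (distribˡ _ _ _))) (∑□-+ box _ _)

    tuples-*ˡ : ∀ {n} box (fs : Vec (Fam R) n) x (F : Vec N2 n → Carrier) →
      tuples box fs (λ is → x * F is) ≈ x * tuples box fs F
    tuples-*ˡ box [] x F = refl
    tuples-*ˡ box (f ∷ fs) x F =
      trans (∑□-cong box (λ i → trans (*-congˡ (tuples-*ˡ box fs x _)) (*-swapˡ _ _ _))) (sym (*-∑□ box x _))

    tuples-*ʳ : ∀ {n} box (fs : Vec (Fam R) n) x (F : Vec N2 n → Carrier) →
      tuples box fs F * x ≈ tuples box fs (λ is → F is * x)
    tuples-*ʳ box fs x F =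
      trans (*-comm _ _) (trans (sym (tuples-*ˡ box fs x F)) (tuples-cong box fs (λ is → *-comm _ _)))

    tuples-∑ : ∀ {n} box (fs : Vec (Fam R) n) m (H : Vec N2 n → ℕ → Carrier) →
      tuples box fs (λ is → ∑ m (H is)) ≈ ∑ m (λ k → tuples box fs (λ is → H is k))
    tuples-∑ box fs zero H = refl
    tuples-∑ box fs (suc m) H = trans (tuples-+ box fs _ _) (+-congʳ (tuples-∑ box fs m H))

    tuples-∑□ : ∀ {n} box (fs : Vec (Fam R) n) box' (H : Vec N2 n → N2 → Carrier) →
      tuples box fs (λ is → ∑□ box' (H is)) ≈ ∑□ box' (λ k → tuples box fs (λ is → H is k))
    tuples-∑□ box fs (a , b) H = trans (tuples-∑ box fs a _) (∑-cong a (λ i → tuples-∑ box fs b _))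

    tuples-⋆-dilate : ∀ {n} box (fs : Vec (Fam R) n) h x (G : Vec N2 n → PS R) a b →
      tuples box fs (λ is → (h ⋆ dilate x (G is)) a b) ≈ (h ⋆ dilate x (λ a' b' → tuples box fs (λ is → G is a' b'))) a b
    tuples-⋆-dilate box fs h x G a b =
      trans (tuples-∑ box fs a _) (∑-cong a (λ i → trans (tuples-∑ box fs b _) (∑-cong b (λ j →
        trans (tuples-*ˡ box fs (h i j) _) (*-congˡ (tuples-*ˡ box fs (x ^ (a ∸ i)) _))))))

    tuples-truncate : ∀ {n} a b a' b' (fs : Vec (Fam R) n) (F : Vec N2 n → Carrier) → a' ≤ a → b' ≤ b →
      (∀ js → SomeOutside (a' , b') js → F js ≈ 0#) → tuples (a , b) fs F ≈ tuples (a' , b') fs F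
    tuples-truncate a b a' b' [] F _ _ h = refl
    tuples-truncate a b a' b' (f ∷ fs) F a'≤a b'≤b h =
      trans (∑□-cong (a , b) (λ i → *-congˡ (tuples-truncate a b a' b' fs (F ∘ (i ∷_)) a'≤a b'≤b
                                                (λ js o → h (i ∷ js) (there o)))))
            (∑□-truncate a b a' b' a'≤a b'≤b (λ i o →
              trans (*-congˡ (tuples-zero (a' , b') fs (λ js → h (i ∷ js) (here o)))) (zeroʳ _)))

    tuples-∷ʳ : ∀ {n} box (fs : Vec (Fam R) n) g (F : Vec N2 (suc n) → Carrier) →
      tuples box (fs ∷ʳ g) F ≈ tuples box fs (λ is → ∑□ box (λ j → g j * F (is ∷ʳ j)))
    tuples-∷ʳ box [] g F = refl
    tuples-∷ʳ box (f ∷ fs) g F = ∑□-cong box (λ i → *-congˡ (tuples-∷ʳ box fs g (F ∘ (i ∷_))))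

    tuples-δ : ∀ {n} box (is : Vec N2 n) (F : Vec N2 n → Carrier) →
      (∀ js → SomeOutside box js → F js ≈ 0#) → tuples box (map (δ R) is) F ≈ F is
    tuples-δ box [] F h = refl
    tuples-δ box (i ∷ is) F h =
      trans (∑□-cong box (λ j → *-congˡ (tuples-δ box is (F ∘ (j ∷_)) (λ js o → h (j ∷ js) (there o)))))
            (trans (∑□-δ box i 1# (λ j → F (j ∷ is)) (λ o → h (i ∷ is) (here o))) (*-identityˡ _))

    Πₙ : ∀ {n} → Vec (Fam R) n → PS R
    Πₙ = Π R q P

    expand : Fam R → PS R
    expand = Expand R q P

    Π-δ : ∀ {n} (is : Vec N2 n) → Πₙ (map (δ R) is) ≋ scale (q ^ B is) (e (vsum is))
    Π-δ is a b = trans (tuples-δ (a , b) is (λ js → Πbasis R q P js a b) (Πbasis-outside a b)) (Πbasis-e is a b)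

    Π-singleton : ∀ d → Πₙ (d ∷ []) ≋ expand d
    Π-singleton d a b =
      ∑□-cong (a , b) (λ i → *-congˡ (trans (⋆-identityʳ (dilate 1# (e i)) a b) (dilate-1 (e i) a b)))

    Π-cong-head : ∀ {n} {d d'} (fs : Vec (Fam R) n) → (∀ i → d i ≈ d' i) → Πₙ (d ∷ fs) ≋ Πₙ (d' ∷ fs)
    Π-cong-head fs d≈d' a b = ∑□-cong (a , b) (λ i → *-congʳ (d≈d' i))

    -- Π₂(f, G) = Σ_i f_i ẽ_i(z,t) G(q^{⟨i,e₂⟩} z, t) for an arbitrary series G
    leftProduct : Fam R → PS R → PS R
    leftProduct f G a b = ∑□ (a , b) (λ i → f i * (e i ⋆ dilate (q ^ proj₂ i) G) a b)

    leftProduct-cong : ∀ f {G G'} → G ≋ G' → leftProduct f G ≋ leftProduct f G'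
    leftProduct-cong f G≋G' a b = ∑□-cong (a , b) (λ i → *-congˡ (⋆-cong ≋-refl (dilate-cong _ G≋G') a b))

    Π-∷ : ∀ {n} f (fs : Vec (Fam R) n) → Πₙ (f ∷ fs) ≋ leftProduct f (Πₙ fs)
    Π-∷ f fs a b = ∑□-cong (a , b) (λ i → *-congˡ (begin
        tuples (a , b) fs (λ is → (dilate 1# (e i) ⋆ ΠbasisFrom R q P (proj₂ i) is) a b)
      ≈⟨ tuples-cong (a , b) fs (λ is → ⋆-cong (dilate-1 (e i)) (ΠbasisFrom-dilate (proj₂ i) is) a b) ⟩
        tuples (a , b) fs (λ is → (e i ⋆ dilate (q ^ proj₂ i) (Πbasis R q P is)) a b)
      ≈⟨ tuples-⋆-dilate (a , b) fs (e i) (q ^ proj₂ i) (Πbasis R q P) a b ⟩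
        (e i ⋆ dilate (q ^ proj₂ i) (λ x y → tuples (a , b) fs (λ is → Πbasis R q P is x y))) a b
      ≈⟨ ⋆-congʳ-in-box (e i) a b (λ x y x≤a y≤b → *-congˡ {(q ^ proj₂ i) ^ x}
           (tuples-truncate a b x y fs (λ js → Πbasis R q P js x y) x≤a y≤b (Πbasis-outside x y))) ⟩
        (e i ⋆ dilate (q ^ proj₂ i) (Πₙ fs)) a b
      ∎))
      where open ≈-Reasoning

    Π-coeff : ∀ {n} → Vec (Fam R) n → Fam R
    Π-coeff hs k = tuples k hs (λ is → δ-at (vsum is) (q ^ B is) k)

    ∑□-Π-coeff : ∀ {n} a b (hs : Vec (Fam R) n) (Y : N2 → Carrier) → (∀ k → Outside (a , b) k → Y k ≈ 0#) →
      ∑□ (a , b) (λ k → Π-coeff hs k * Y k) ≈ tuples (a , b) hs (λ is → q ^ B is * Y (vsum is))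
    ∑□-Π-coeff a b hs Y Y-outside = begin
        ∑□ (a , b) (λ k → tuples k hs (X k) * Y k)
      ≈⟨ ∑□-congᵇ a b (λ k k₁≤a k₂≤b → *-congʳ (sym
           (tuples-truncate a b (proj₁ k) (proj₂ k) hs (X k) k₁≤a k₂≤b (λ js o → X-off k js o)))) ⟩
        ∑□ (a , b) (λ k → tuples (a , b) hs (X k) * Y k)
      ≈⟨ ∑□-cong (a , b) (λ k → tuples-*ʳ (a , b) hs (Y k) (X k)) ⟩
        ∑□ (a , b) (λ k → tuples (a , b) hs (λ is → X k is * Y k))
      ≈⟨ sym (tuples-∑□ (a , b) hs (a , b) (λ is k → X k is * Y k)) ⟩
        tuples (a , b) hs (λ is → ∑□ (a , b) (λ k → X k is * Y k))
      ≈⟨ tuples-cong (a , b) hs (λ is → ∑□-δ (a , b) (vsum is) (q ^ B is) Y (Y-outside (vsum is))) ⟩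
        tuples (a , b) hs (λ is → q ^ B is * Y (vsum is))
      ∎
      where
      open ≈-Reasoning
      X : N2 → Vec N2 _ → Carrier
      X k is = δ-at (vsum is) (q ^ B is) k
      X-off : ∀ k js → SomeOutside k js → X k js ≈ 0#
      X-off k js o with vsum js ≟₂ k
      ... | yes vsum≡k = ⊥-elim (Outside⇒≢ k (vsum js) (SomeOutside-vsum k js o) vsum≡k)
      ... | no _ = refl

    Π-expansion : ∀ {n} (hs : Vec (Fam R) n) → Πₙ hs ≋ expand (Π-coeff hs)
    Π-expansion hs a b =
      trans (tuples-cong (a , b) hs (λ is → Πbasis-e is a b))
            (sym (∑□-Π-coeff a b hs (λ k → e k a b) (e-outside a b)))

    Π-∷ʳ : ∀ {n} (hs : Vec (Fam R) n) g → Πₙ (hs ∷ʳ g) ≋ Πₙ (Π-coeff hs ∷ g ∷ [])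
    Π-∷ʳ hs g a b = begin
        tuples (a , b) (hs ∷ʳ g) (λ is → Πbasis R q P is a b)
      ≈⟨ tuples-∷ʳ (a , b) hs g (λ is → Πbasis R q P is a b) ⟩
        tuples (a , b) hs (λ is → ∑□ (a , b) (λ j → g j * Πbasis R q P (is ∷ʳ j) a b))
      ≈⟨ tuples-cong (a , b) hs (λ is → trans (∑□-cong (a , b) (λ j → last-factor is j)) (sym (*-∑□ (a , b) _ _))) ⟩
        tuples (a , b) hs (λ is → q ^ B is * Y (vsum is))
      ≈⟨ sym (∑□-Π-coeff a b hs Y Y-outside) ⟩
        ∑□ (a , b) (λ k → Π-coeff hs k * Y k)
      ≈⟨ sym (∑□-cong (a , b) (λ k → *-congˡ (∑□-cong (a , b) (λ j → *-congˡ (Πbasis-pair k j a b))))) ⟩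
        Πₙ (Π-coeff hs ∷ g ∷ []) a b
      ∎
      where
      open ≈-Reasoning
      Y : N2 → Carrier
      Y k = ∑□ (a , b) (λ j → g j * (q ^ (proj₂ k ℕ.* proj₁ j) * e (k ⊕ j) a b))
      Y-outside : ∀ k → Outside (a , b) k → Y k ≈ 0#
      Y-outside k o = ∑□-zero (a , b) (λ j →
        trans (*-congˡ (trans (*-congˡ (e-outside a b (k ⊕ j) (Outside-⊕ˡ (a , b) k j o))) (zeroʳ _))) (zeroʳ _))
      last-factor : ∀ {n} (is : Vec N2 n) j →
        g j * Πbasis R q P (is ∷ʳ j) a b ≈ q ^ B is * (g j * (q ^ (proj₂ (vsum is) ℕ.* proj₁ j) * e (vsum is ⊕ j) a b))
      last-factor is j = trans (*-congˡ (trans (Πbasis-e (is ∷ʳ j) a b)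
        (trans (*-cong (trans (≡⇒≈ (≡.cong (q ^_) (B-∷ʳ is j))) (^-+ q (B is) _))
                       (≡⇒≈ (≡.cong (λ k → e k a b) (vsum-∷ʳ is j))))
               (*-assoc _ _ _))))
        (*-swapˡ _ _ _)

    -- Uniqueness of basis expansions, by triangularity.

    expand-vanishes : ∀ Δ → (∀ a b → expand Δ a b ≈ 0#) → ∀ k → Δ k ≈ 0#
    expand-vanishes Δ expand≈0 (a , b) = below (a ℕ.+ b) a b ℕₚ.≤-refl
      where
      corner : ∀ a b → (∀ i j → i ℕ.+ j < a ℕ.+ b → Δ (i , j) ≈ 0#) → Δ (a , b) ≈ 0#
      corner a b smaller = begin
          Δ (a , b)                              ≈⟨ sym (trans (*-congˡ (e-corner a b)) (*-identityʳ _)) ⟩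
          Δ (a , b) * e (a , b) a b              ≈⟨ sym (∑-last b lower-in-column) ⟩
          ∑ b (λ j → Δ (a , j) * e (a , j) a b)  ≈⟨ sym (∑-last a earlier-columns) ⟩
          expand Δ a b                           ≈⟨ expand≈0 a b ⟩
          0#                                     ∎
        where
        open ≈-Reasoning
        lower-in-column : ∀ j → j < b → Δ (a , j) * e (a , j) a b ≈ 0#
        lower-in-column j j<b = trans (*-congʳ (smaller a j (ℕₚ.+-monoʳ-< a j<b))) (zeroˡ _)
        earlier-columns : ∀ i → i < a → ∑ b (λ j → Δ (i , j) * e (i , j) a b) ≈ 0#
        earlier-columns i i<a =
          ∑-zero b (λ j j≤b → trans (*-congʳ (smaller i j (ℕₚ.+-mono-<-≤ i<a j≤b))) (zeroˡ _))
      below : ∀ n a b → a ℕ.+ b ≤ n → Δ (a , b) ≈ 0#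
      below zero a b a+b≤0 = corner a b (λ i j lt → ⊥-elim (ℕₚ.<⇒≱ (ℕₚ.<-≤-trans lt a+b≤0) z≤n))
      below (suc n) a b a+b≤n = corner a b (λ i j lt → below n i j (ℕₚ.≤-pred (ℕₚ.<-≤-trans lt a+b≤n)))

    expand-injective : ∀ d d' → expand d ≋ expand d' → ∀ k → d k ≈ d' k
    expand-injective d d' d≋d' k = x∙y⁻¹≈ε⇒x≈y (d k) (d' k) (expand-vanishes (λ i → d i - d' i) difference k)
      where
      difference : ∀ a b → expand (λ i → d i - d' i) a b ≈ 0#
      difference a b = begin
          ∑□ (a , b) (λ i → (d i - d' i) * e i a b)
        ≈⟨ ∑□-cong (a , b) (λ i → [y-z]x≈yx-zx (e i a b) (d i) (d' i)) ⟩
          ∑□ (a , b) (λ i → d i * e i a b - d' i * e i a b)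
        ≈⟨ trans (∑□-+ (a , b) _ _) (+-congˡ (∑□-neg (a , b) _)) ⟩
          expand d a b - expand d' a b
        ≈⟨ +-congʳ (d≋d' a b) ⟩
          expand d' a b - expand d' a b
        ≈⟨ -‿inverseʳ _ ⟩
          0#
        ∎
        where open ≈-Reasoning

    -- Part (ii): Π_n(f₁,…,fₙ) = Π₂(f₁, Π_{n-1}(f₂,…)) = Π₂(Π_{n-1}(…,f_{n-1}), fₙ),
    -- where Π_{n-1}(…) enters through its basis expansion d.
    Π-assocˡ : ∀ {n} f (fs : Vec (Fam R) n) d → expand d ≋ Πₙ fs → Πₙ (f ∷ fs) ≋ Πₙ (f ∷ d ∷ [])
    Π-assocˡ f fs d d≋fs = begin
      Πₙ (f ∷ fs)                       ≈⟨ Π-∷ f fs ⟩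
      leftProduct f (Πₙ fs)             ≈⟨ leftProduct-cong f (≋-trans (≋-sym d≋fs) (≋-sym (Π-singleton d))) ⟩
      leftProduct f (Πₙ (d ∷ []))       ≈⟨ ≋-sym (Π-∷ f (d ∷ [])) ⟩
      Πₙ (f ∷ d ∷ [])                   ∎
      where open ≋-Reasoning

    Π-assocʳ : ∀ {n} (hs : Vec (Fam R) n) g d → expand d ≋ Πₙ hs → Πₙ (hs ∷ʳ g) ≋ Πₙ (d ∷ g ∷ [])
    Π-assocʳ hs g d d≋hs =
      ≋-trans (Π-∷ʳ hs g) (Π-cong-head (g ∷ []) (λ k → sym (d≈C k)))
      where
      d≈C : ∀ k → d k ≈ Π-coeff hs k
      d≈C = expand-injective d (Π-coeff hs) (≋-trans d≋hs (Π-expansion hs))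

    Π-assoc : ∀ m (fs : Vec (Fam R) (suc (suc m))) d₁ d₂ → expand d₁ ≋ Πₙ (tail fs) → expand d₂ ≋ Πₙ (init fs) →
      Πₙ fs ≋ Πₙ (head fs ∷ d₁ ∷ []) × Πₙ fs ≋ Πₙ (d₂ ∷ last fs ∷ [])
    Π-assoc m fs@(f ∷ fs') d₁ d₂ d₁≋tail d₂≋init =
        Π-assocˡ f fs' d₁ d₁≋tail
      , ≡.subst (λ gs → Πₙ gs ≋ Πₙ (d₂ ∷ last fs ∷ [])) (≡.sym (proj₂ (proj₂ (initLast fs))))
                (Π-assocʳ (init fs) (last fs) d₂ d₂≋init)

    Π-pair : ∀ f g a b → Πₙ (f ∷ g ∷ []) a b ≈
      ∑□ (a , b) (λ i → ∑□ (a , b) (λ j → (q ^ ℤ.∣ ℤ.+ B (i ∷ j ∷ []) ℤ.+ det i j ∣ * (g i * f j)) * e (i ⊕ j) a b))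
    Π-pair f g a b = begin
        ∑□ (a , b) (λ i → f i * ∑□ (a , b) (λ j → g j * Πbasis R q P (i ∷ j ∷ []) a b))
      ≈⟨ ∑□-cong (a , b) (λ i → trans (*-congˡ (∑□-cong (a , b) (λ j → *-congˡ (Πbasis-pair i j a b))))
                                      (*-∑□ (a , b) (f i) _)) ⟩
        ∑□ (a , b) (λ v → ∑□ (a , b) (λ u → f v * (g u * (q ^ (proj₂ v ℕ.* proj₁ u) * e (v ⊕ u) a b))))
      ≈⟨ ∑□-swap (a , b) _ ⟩
        ∑□ (a , b) (λ u → ∑□ (a , b) (λ v → f v * (g u * (q ^ (proj₂ v ℕ.* proj₁ u) * e (v ⊕ u) a b))))
      ≈⟨ ∑□-cong (a , b) (λ u → ∑□-cong (a , b) (λ v → rearrange u v)) ⟩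
        ∑□ (a , b) (λ u → ∑□ (a , b) (λ v → (q ^ ℤ.∣ ℤ.+ B (u ∷ v ∷ []) ℤ.+ det u v ∣ * (g u * f v)) * e (u ⊕ v) a b))
      ∎
      where
      open ≈-Reasoning
      rearrange : ∀ u v → f v * (g u * (q ^ (proj₂ v ℕ.* proj₁ u) * e (v ⊕ u) a b)) ≈
                          (q ^ ℤ.∣ ℤ.+ B (u ∷ v ∷ []) ℤ.+ det u v ∣ * (g u * f v)) * e (u ⊕ v) a b
      rearrange u v = begin
          f v * (g u * (Q * E))    ≈⟨ trans (*-swapˡ _ _ _) (*-congˡ (*-swapˡ _ _ _)) ⟩
          g u * (Q * (f v * E))    ≈⟨ trans (*-swapˡ _ _ _) (*-congˡ (sym (*-assoc _ _ _))) ⟩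
          Q * ((g u * f v) * E)    ≈⟨ sym (*-assoc _ _ _) ⟩
          (Q * (g u * f v)) * E    ≈⟨ *-cong (*-congʳ (≡⇒≈ (≡.cong (q ^_) (≡.sym (B+det u v)))))
                                              (≡⇒≈ (≡.cong (λ k → e k a b) (⊕-comm v u))) ⟩
          (q ^ ℤ.∣ ℤ.+ B (u ∷ v ∷ []) ℤ.+ det u v ∣ * (g u * f v)) * e (u ⊕ v) a b
        ∎
        where
        Q E : Carrier
        Q = q ^ (proj₂ v ℕ.* proj₁ u)
        E = e (v ⊕ u) a b

proposition4p8p1 : ∀ {c ℓ} (R : CommutativeRing c ℓ) (q : CommutativeRing.Carrier R) (P : PS R) →
    Catalan R P →
    (∀ (m : ℕ) (is : Vec N2 (suc m)) →
      _≈ₚ_ R (Π R q P (map (δ R) is)) (scal R (pow R q (B is)) (ẽ R q P (vsum is))))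
    × (∀ (m : ℕ) (fs : Vec (Fam R) (suc (suc m))) (d₁ d₂ : Fam R) →
      _≈ₚ_ R (Expand R q P d₁) (Π R q P (tail fs)) →
      _≈ₚ_ R (Expand R q P d₂) (Π R q P (init fs)) →
      _≈ₚ_ R (Π R q P fs) (Π R q P (head fs ∷ d₁ ∷ []))
      × _≈ₚ_ R (Π R q P fs) (Π R q P (d₂ ∷ last fs ∷ [])))
    × (∀ (f g : Fam R) →
      _≈ₚ_ R (Π R q P (f ∷ g ∷ []))
        (λ a b → Σbox R (a , b) λ i → Σbox R (a , b) λ j →
          CommutativeRing._*_ R
            (CommutativeRing._*_ R
              (pow R q ℤ.∣ ℤ.+ B (i ∷ j ∷ []) ℤ.+ det i j ∣)
              (CommutativeRing._*_ R (g i) (f j)))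
            (ẽ R q P (i ⊕ j) a b)))
proposition4p8p1 R q P catalan = (λ _ → Π-δ) , Π-assoc , Π-pair
  where open Theory.Basis R q P catalan
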